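{- Let $\underline D=(D,\le,0,1,+,\cdot,C,\widehat C,\ll)$ be an EDC-lattice, $PF(D)$ and $PI(D)$ its sets of prime filters and prime ideals. Define $R^c$ on $PF(D)$ by: $\Gamma R^c\Delta$ iff for all $a,b\in D$: ($a\in\Gamma$, $b\in\Delta\Rightarrow aCb$), ($a\notin\Gamma$, $b\notin\Delta\Rightarrow a\widehat Cb$), ($a\in\Gamma$, $b\notin\Delta\Rightarrow$ not $a\ll b$), ($a\notin\Gamma$, $b\in\Delta\Rightarrow$ not $b\ll a$); and $\widehat R^c$ on $PI(D)$ by $\Gamma\widehat R^c\Delta$ iff $(D\setminus\Gamma)R^c(D\setminus\Delta)$. Then $R^c$ and $\widehat R^c$ are reflexive and symmetric.
   Context: An EDC-lattice is a structure $(D,\le,0,1,+,\cdot,C,\widehat C,\ll)$ where $(D,\le,0,1,+,\cdot)$ is a bounded distributive lattice and $C,\widehat C,\ll$ are binary relations on $D$ such that for all $a,a',b,b',c,d\in D$ (writing $\overline R$ for the complement of a relation $R$): (C1) $aCb\Rightarrow a\neq0,b\ne 0$; (C2) $aCb$, $a\le a'$, $b\le b'\Rightarrow a'Cb'$; (C3) $aC(b+c)\Rightarrow aCb$ or $aCc$; (C4) $aCb\Rightarrow bCa$; (C5) $a\cdot b\ne0\Rightarrow aCb$; ($\widehat C$1) $a\widehat Cb\Rightarrow a\ne1,b\ne1$; ($\widehat C$2) $a\widehat Cb$, $a'\le a$, $b'\le b\Rightarrow a'\widehat Cb'$; ($\widehat C$3) $a\widehat C(b\cdot c)\Rightarrow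 a\widehat Cb$ or $a\widehat Cc$; ($\widehat C$4) $a\widehat Cb\Rightarrow b\widehat Ca$; ($\widehat C$5) $a+b\ne1\Rightarrow a\widehat Cb$; ($\ll$1) $0\ll0$; ($\ll$2) $1\ll1$; ($\ll$3) $a\ll b\Rightarrow a\le b$; ($\ll$4) $a'\le a\ll b\le b'\Rightarrow a'\ll b'$; ($\ll$5) $a\ll c$, $b\ll c\Rightarrow a+b\ll c$; ($\ll$6) $c\ll a$, $c\ll b\Rightarrow c\ll a\cdot b$; ($\ll$7) $a\ll b$, $b\cdot c\ll d$, $c\ll a+d\Rightarrow c\ll d$; (MC1) $aCb$, $a\ll c\Rightarrow aC(b\cdot c)$; (MC2) $a\overline C(b\cdot c)$, $aCb$, $(a\cdot d)\overline Cb\Rightarrow d\widehat Cc$; (M$\widehat C$1) $a\widehat Cb$, $c\ll a\Rightarrow a\widehat C(b+c)$; (M$\widehat C$2) $a\overline{\widehat C}(b+c)$, $a\widehat Cb$, $(a+d)\overline{\widehat C}b\Rightarrow dCc$; (M$\ll$1) $a\overline{\widehat C}b$, $a\cdot c\ll b\Rightarrow c\ll b$; (M$\ll$2) $a\overline Cb$, $b\ll a+c\Rightarrow b\ll c$. Prime filters/ideals are as usual for bounded distributive lattices (proper, and prime with respect to $+$ resp. $\cdot$). -}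

module Defs where

open import Level using (Level; _⊔_) renaming (suc to lsuc)
open import Algebra.Lattice.Bundles using (DistributiveLattice)
open import Relation.Binary.Core using (Rel)
open import Relation.Unary using (Pred; _∈_; _∉_; ∁)
open import Relation.Nullary using (¬_)
open import Data.Product using (_×_)
open import Data.Sum using (_⊎_)

-- Conventions: lattice join ∨ is the paper's +, meet ∧ is the paper's ·,
-- equality is the lattice setoid equality ≈, and a ≤ b  :⇔  a ∧ b ≈ a.

module _ {c ℓ : Level} (L : DistributiveLattice c ℓ) where
  open DistributiveLattice L

  _≤_ : Rel Carrier ℓ
  a ≤ b = (a ∧ b) ≈ a

  _̅ : {r : Level} → Rel Carrier r → Rel Carrier r
  (R ̅) a b = ¬ R a b

  record IsEDCLattice {r : Level} (𝟎 𝟏 : Carrier) (C Ĉ ≪ : Rel Carrier r)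
         : Set (c ⊔ ℓ ⊔ r) where
    field
      𝟎-least    : ∀ a → 𝟎 ≤ a
      𝟏-greatest : ∀ a → a ≤ 𝟏
      C1 : ∀ {a b} → C a b → (¬ a ≈ 𝟎) × (¬ b ≈ 𝟎)
      C2 : ∀ {a a' b b'} → C a b → a ≤ a' → b ≤ b' → C a' b'
      C3 : ∀ {a b c} → C a (b ∨ c) → C a b ⊎ C a c
      C4 : ∀ {a b} → C a b → C b a
      C5 : ∀ {a b} → ¬ (a ∧ b) ≈ 𝟎 → C a b
      Ĉ1 : ∀ {a b} → Ĉ a b → (¬ a ≈ 𝟏) × (¬ b ≈ 𝟏)
      Ĉ2 : ∀ {a a' b b'} → Ĉ a b → a' ≤ a → b' ≤ b → Ĉ a' b'
      Ĉ3 : ∀ {a b c} → Ĉ a (b ∧ c) → Ĉ a b ⊎ Ĉ a c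
      Ĉ4 : ∀ {a b} → Ĉ a b → Ĉ b a
      Ĉ5 : ∀ {a b} → ¬ (a ∨ b) ≈ 𝟏 → Ĉ a b
      ≪1 : ≪ 𝟎 𝟎
      ≪2 : ≪ 𝟏 𝟏
      ≪3 : ∀ {a b} → ≪ a b → a ≤ b
      ≪4 : ∀ {a a' b b'} → a' ≤ a → ≪ a b → b ≤ b' → ≪ a' b'
      ≪5 : ∀ {a b c} → ≪ a c → ≪ b c → ≪ (a ∨ b) c
      ≪6 : ∀ {a b c} → ≪ c a → ≪ c b → ≪ c (a ∧ b)
      ≪7 : ∀ {a b c d} → ≪ a b → ≪ (b ∧ c) d → ≪ c (a ∨ d) → ≪ c d
      MC1  : ∀ {a b c} → C a b → ≪ a c → C a (b ∧ c)
      MC2  : ∀ {a b c d} → (C ̅) a (b ∧ c) → C a b → (C ̅) (a ∧ d) b → Ĉ d c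
      MĈ1  : ∀ {a b c} → Ĉ a b → ≪ c a → Ĉ a (b ∨ c)
      MĈ2  : ∀ {a b c d} → (Ĉ ̅) a (b ∨ c) → Ĉ a b → (Ĉ ̅) (a ∨ d) b → C d c
      M≪1  : ∀ {a b c} → (Ĉ ̅) a b → ≪ (a ∧ c) b → ≪ c b
      M≪2  : ∀ {a b c} → (C ̅) a b → ≪ b (a ∨ c) → ≪ b c

record EDCLattice (c ℓ r : Level) : Set (lsuc (c ⊔ ℓ ⊔ r)) where
  field
    distLattice : DistributiveLattice c ℓ
  open DistributiveLattice distLattice public
  field
    𝟎 𝟏 : Carrier
    C Ĉ ≪ : Rel Carrier r
    isEDCLattice : IsEDCLattice distLattice 𝟎 𝟏 C Ĉ ≪
  open IsEDCLattice isEDCLattice public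

module _ {c ℓ r : Level} (D : EDCLattice c ℓ r) where
  open EDCLattice D
  private
    _≤D_ = _≤_ distLattice

  record IsPrimeFilter {p : Level} (Γ : Pred Carrier p) : Set (c ⊔ ℓ ⊔ p) where
    field
      up     : ∀ {a b} → a ∈ Γ → a ≤D b → b ∈ Γ
      has𝟏   : 𝟏 ∈ Γ
      meet   : ∀ {a b} → a ∈ Γ → b ∈ Γ → (a ∧ b) ∈ Γ
      proper : 𝟎 ∉ Γ
      prime  : ∀ {a b} → (a ∨ b) ∈ Γ → a ∈ Γ ⊎ b ∈ Γ

  record IsPrimeIdeal {p : Level} (Γ : Pred Carrier p) : Set (c ⊔ ℓ ⊔ p) where
    field
      down   : ∀ {a b} → b ∈ Γ → a ≤D b → a ∈ Γ
      has𝟎   : 𝟎 ∈ Γ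
      join   : ∀ {a b} → a ∈ Γ → b ∈ Γ → (a ∨ b) ∈ Γ
      proper : 𝟏 ∉ Γ
      prime  : ∀ {a b} → (a ∧ b) ∈ Γ → a ∈ Γ ⊎ b ∈ Γ

  Rᶜ : {p : Level} → Pred Carrier p → Pred Carrier p → Set (c ⊔ r ⊔ p)
  Rᶜ Γ Δ = ∀ a b →
      (a ∈ Γ → b ∈ Δ → C a b)
    × (a ∉ Γ → b ∉ Δ → Ĉ a b)
    × (a ∈ Γ → b ∉ Δ → ¬ ≪ a b)
    × (a ∉ Γ → b ∈ Δ → ¬ ≪ b a)

  R̂ᶜ : {p : Level} → Pred Carrier p → Pred Carrier p → Set (c ⊔ r ⊔ p)
  R̂ᶜ Γ Δ = Rᶜ (∁ Γ) (∁ Δ)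

module Submission where

open import Defs
open import Level using (Level; _⊔_)
open import Relation.Unary using (Pred; _∈_; _∉_; ∁)
open import Data.Product using (_×_; _,_)
open import Data.Sum using ([_,_])

module _ {c ℓ r : Level} (D : EDCLattice c ℓ r) where
  open EDCLattice D

  private
    _≤D_ = _≤_ distLattice

  ≈𝟎⇒≤𝟎 : ∀ {x} → x ≈ 𝟎 → x ≤D 𝟎
  ≈𝟎⇒≤𝟎 {x} x≈𝟎 = trans (trans (∧-comm x 𝟎) (𝟎-least x)) (sym x≈𝟎)

  ≈𝟏⇒𝟏≤ : ∀ {y} → y ≈ 𝟏 → 𝟏 ≤D y
  ≈𝟏⇒𝟏≤ {y} y≈𝟏 = trans (trans (∧-comm 𝟏 y) (𝟏-greatest y)) y≈𝟏

  -- Primality only in contrapositive form: unlike primality itself, it holds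
  -- constructively for the complement of a prime ideal.
  record IsWeaklyPrimeFilter {p : Level} (Γ : Pred Carrier p) : Set (c ⊔ ℓ ⊔ p) where
    field
      up     : ∀ {a b} → a ∈ Γ → a ≤D b → b ∈ Γ
      has𝟏   : 𝟏 ∈ Γ
      meet   : ∀ {a b} → a ∈ Γ → b ∈ Γ → (a ∧ b) ∈ Γ
      proper : 𝟎 ∉ Γ
      ∉-join : ∀ {a b} → a ∉ Γ → b ∉ Γ → (a ∨ b) ∉ Γ

  isPrimeFilter⇒isWeaklyPrimeFilter : ∀ {p} {Γ : Pred Carrier p} →
    IsPrimeFilter D Γ → IsWeaklyPrimeFilter Γ
  isPrimeFilter⇒isWeaklyPrimeFilter F = record
    { up     = up
    ; has𝟏   = has𝟏
    ; meet   = meet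
    ; proper = proper
    ; ∉-join = λ a∉Γ b∉Γ a∨b∈Γ → [ a∉Γ , b∉Γ ] (prime a∨b∈Γ)
    }
    where open IsPrimeFilter F

  ∁-isPrimeIdeal⇒isWeaklyPrimeFilter : ∀ {p} {Γ : Pred Carrier p} →
    IsPrimeIdeal D Γ → IsWeaklyPrimeFilter (∁ Γ)
  ∁-isPrimeIdeal⇒isWeaklyPrimeFilter I = record
    { up     = λ a∉Γ a≤b b∈Γ → a∉Γ (down b∈Γ a≤b)
    ; has𝟏   = proper
    ; meet   = λ a∉Γ b∉Γ a∧b∈Γ → [ a∉Γ , b∉Γ ] (prime a∧b∈Γ)
    ; proper = λ 𝟎∉Γ → 𝟎∉Γ has𝟎
    ; ∉-join = λ ¬a∉Γ ¬b∉Γ a∨b∉Γ → ¬a∉Γ (λ a∈Γ → ¬b∉Γ (λ b∈Γ → a∨b∉Γ (join a∈Γ b∈Γ)))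
    }
    where open IsPrimeIdeal I

  Rᶜ-refl : ∀ {p} {Γ : Pred Carrier p} → IsWeaklyPrimeFilter Γ → Rᶜ D Γ Γ
  Rᶜ-refl F a b =
      (λ a∈Γ b∈Γ → C5 (λ a∧b≈𝟎 → proper (up (meet a∈Γ b∈Γ) (≈𝟎⇒≤𝟎 a∧b≈𝟎))))
    , (λ a∉Γ b∉Γ → Ĉ5 (λ a∨b≈𝟏 → ∉-join a∉Γ b∉Γ (up has𝟏 (≈𝟏⇒𝟏≤ a∨b≈𝟏))))
    , (λ a∈Γ b∉Γ a≪b → b∉Γ (up a∈Γ (≪3 a≪b)))
    , (λ a∉Γ b∈Γ b≪a → a∉Γ (up b∈Γ (≪3 b≪a)))
    where open IsWeaklyPrimeFilter F

  Rᶜ-sym : ∀ {p} {Γ Δ : Pred Carrier p} → Rᶜ D Γ Δ → Rᶜ D Δ Γ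
  Rᶜ-sym ΓRΔ a b =
    let (inC , outĈ , in-out-≪̸ , out-in-≪̸) = ΓRΔ b a in
      (λ a∈Δ b∈Γ → C4 (inC b∈Γ a∈Δ))
    , (λ a∉Δ b∉Γ → Ĉ4 (outĈ b∉Γ a∉Δ))
    , (λ a∈Δ b∉Γ → out-in-≪̸ b∉Γ a∈Δ)
    , (λ a∉Δ b∈Γ → in-out-≪̸ b∈Γ a∉Δ)

mainTheorem16 : {c ℓ r p : Level} (D : EDCLattice c ℓ r) →
    -- R^c is reflexive on PF(D)
    ((Γ : Pred (EDCLattice.Carrier D) p) → IsPrimeFilter D Γ → Rᶜ D Γ Γ)
    -- R^c is symmetric on PF(D)
  × ((Γ Δ : Pred (EDCLattice.Carrier D) p) → IsPrimeFilter D Γ → IsPrimeFilter D Δ →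
       Rᶜ D Γ Δ → Rᶜ D Δ Γ)
    -- R̂^c is reflexive on PI(D)
  × ((Γ : Pred (EDCLattice.Carrier D) p) → IsPrimeIdeal D Γ → R̂ᶜ D Γ Γ)
    -- R̂^c is symmetric on PI(D)
  × ((Γ Δ : Pred (EDCLattice.Carrier D) p) → IsPrimeIdeal D Γ → IsPrimeIdeal D Δ →
       R̂ᶜ D Γ Δ → R̂ᶜ D Δ Γ)
mainTheorem16 D =
    (λ _ F → Rᶜ-refl D (isPrimeFilter⇒isWeaklyPrimeFilter D F))
  , (λ _ _ _ _ → Rᶜ-sym D)
  , (λ _ I → Rᶜ-refl D (∁-isPrimeIdeal⇒isWeaklyPrimeFilter D I))
  , (λ _ _ _ _ → Rᶜ-sym D)
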